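{- Let $F=(F_n)$ be a semiring family of graphs, and let $\eta$ be any one of $\eta_F$, $\eta_{F,f}$, $\eta_{F,\infty}$. Then for all finite graphs $G,H$, \[ \eta(G+H)\le\eta(G)+\eta(H) \quad\text{and}\quad \eta(G\ltimes H)\le\eta(G\ast H)\le\eta(G)\,\eta(H). \]
   Context: Graphs are undirected simple graphs, possibly infinite; $X\to Y$ denotes existence of a graph homomorphism. The join $G+H$ is the disjoint union with all edges between the two parts added. The disjunctive product $G\ast H$ has vertex set $V(G)\times V(H)$ with $(v,w)\sim(v',w')$ iff $v\sim v'$ or $w\sim w'$; $G^{\ast n}$ is the $n$-fold power. The lexicographic product $G\ltimes H$ has vertex set $V(G)\times V(H)$ with $(v,w)\sim(v',w')$ iff $v\sim v'$, or $v=v'$ and $w\sim w'$. For $d\in\mathbb{N}_+$, $G/d$ is the graph of $d$-cliques of $G$, with $S\sim T$ iff $S\cap T=\emptyset$ and $s\sim t$ for all $s\in S,t\in T$. A semiring family is a sequence $(F_n)_{n\in\mathbb{N}}$ with $F_0=\emptyset$, $F_1\ne\emptyset$, $F_n+F_m\to F_{n+m}$ and $F_n\ast F_m\to F_{nm}$. For finite $G$: $\eta_F(G)=\min\{n\in\mathbb{N}: G\to F_n\}$; $\eta_{F,f}(G)=\inf\{n/d: n\in\mathbb{N},d\in\mathbb{N}_+, G\to F_n/d\}$; $\eta_{F,\infty}(G)=\inf_{n\ge1}\sqrt[n]{\eta_F(G^{\ast n})}$. -}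

module Defs where

open import Data.Nat as ℕ using (ℕ; zero; suc)
open import Data.Integer using (+_)
open import Data.Rational as ℚ using (ℚ; _/_; 0ℚ; 1ℚ)
open import Data.Fin using (Fin; zero)
open import Data.Product using (Σ; ∃; _×_; _,_; proj₁; proj₂)
open import Data.Sum using (_⊎_; inj₁; inj₂)
open import Data.Unit using (⊤; tt)
open import Data.Empty using (⊥)
open import Function.Bundles using (_↔_)
open import Relation.Nullary using (¬_)
open import Relation.Binary.PropositionalEquality using (_≡_; _≢_; refl) renaming (sym to ≡-sym)

record Graph : Set₁ where
  field
    V     : Set
    E     : V → V → Set
    esym  : ∀ {x y} → E x y → E y x
    eirr  : ∀ {x} → ¬ E x x
open Graph public

Finite : Graph → Set
Finite G = Σ ℕ λ k → V G ↔ Fin k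

_⟶_ : Graph → Graph → Set
X ⟶ Y = Σ (V X → V Y) λ f → ∀ {x y} → E X x y → E Y (f x) (f y)

infix 3 _⟶_

joinE : (G H : Graph) → V G ⊎ V H → V G ⊎ V H → Set
joinE G H (inj₁ a) (inj₁ b) = E G a b
joinE G H (inj₁ a) (inj₂ b) = ⊤
joinE G H (inj₂ a) (inj₁ b) = ⊤
joinE G H (inj₂ a) (inj₂ b) = E H a b

joinSym : (G H : Graph) → ∀ {x y} → joinE G H x y → joinE G H y x
joinSym G H {inj₁ a} {inj₁ b} e = esym G e
joinSym G H {inj₁ a} {inj₂ b} e = tt
joinSym G H {inj₂ a} {inj₁ b} e = tt
joinSym G H {inj₂ a} {inj₂ b} e = esym H e

joinIrr : (G H : Graph) → ∀ {x} → ¬ joinE G H x x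
joinIrr G H {inj₁ a} e = eirr G e
joinIrr G H {inj₂ a} e = eirr H e

_⊕_ : Graph → Graph → Graph
G ⊕ H = record
  { V = V G ⊎ V H ; E = joinE G H ; esym = λ {x} {y} → joinSym G H {x} {y} ; eirr = λ {x} → joinIrr G H {x} }

disjSym : (G H : Graph) → ∀ {x y : V G × V H} →
          (E G (proj₁ x) (proj₁ y) ⊎ E H (proj₂ x) (proj₂ y)) →
          (E G (proj₁ y) (proj₁ x) ⊎ E H (proj₂ y) (proj₂ x))
disjSym G H (inj₁ e) = inj₁ (esym G e)
disjSym G H (inj₂ e) = inj₂ (esym H e)

disjIrr : (G H : Graph) → ∀ {x : V G × V H} →
          ¬ (E G (proj₁ x) (proj₁ x) ⊎ E H (proj₂ x) (proj₂ x))
disjIrr G H (inj₁ e) = eirr G e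
disjIrr G H (inj₂ e) = eirr H e

_∗_ : Graph → Graph → Graph
G ∗ H = record
  { V = V G × V H
  ; E = λ x y → E G (proj₁ x) (proj₁ y) ⊎ E H (proj₂ x) (proj₂ y)
  ; esym = disjSym G H ; eirr = disjIrr G H }

-- Disjunctive powers: dpow G n = G^{∗(n+1)}  (G^{∗1} = G, G^{∗(n+2)} = G ∗ G^{∗(n+1)}).
dpow : Graph → ℕ → Graph
dpow G zero    = G
dpow G (suc n) = G ∗ dpow G n

lexSym : (G H : Graph) → ∀ {x y : V G × V H} →
         (E G (proj₁ x) (proj₁ y) ⊎ (proj₁ x ≡ proj₁ y × E H (proj₂ x) (proj₂ y))) →
         (E G (proj₁ y) (proj₁ x) ⊎ (proj₁ y ≡ proj₁ x × E H (proj₂ y) (proj₂ x)))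
lexSym G H (inj₁ e) = inj₁ (esym G e)
lexSym G H (inj₂ (p , e)) = inj₂ (≡-sym p , esym H e)

lexIrr : (G H : Graph) → ∀ {x : V G × V H} →
         ¬ (E G (proj₁ x) (proj₁ x) ⊎ (proj₁ x ≡ proj₁ x × E H (proj₂ x) (proj₂ x)))
lexIrr G H (inj₁ e) = eirr G e
lexIrr G H (inj₂ (_ , e)) = eirr H e

_⋉_ : Graph → Graph → Graph
G ⋉ H = record
  { V = V G × V H
  ; E = λ x y → E G (proj₁ x) (proj₁ y) ⊎ (proj₁ x ≡ proj₁ y × E H (proj₂ x) (proj₂ y))
  ; esym = lexSym G H ; eirr = lexIrr G H }

-- Clique graph G / d  (here with d = suc d', so d ≥ 1).
-- A d-clique is represented by an enumeration Fin d → V G of pairwise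
-- adjacent (hence distinct) vertices.

record Clique (G : Graph) (d : ℕ) : Set where
  field
    elt  : Fin d → V G
    adj  : ∀ i j → i ≢ j → E G (elt i) (elt j)
open Clique public

cliqueE : (G : Graph) (d : ℕ) → Clique G d → Clique G d → Set
cliqueE G d S T = (∀ i j → elt S i ≢ elt T j) × (∀ i j → E G (elt S i) (elt T j))

cliqueSym : (G : Graph) (d : ℕ) → ∀ {S T} → cliqueE G d S T → cliqueE G d T S
cliqueSym G d (dis , a) = (λ i j p → dis j i (≡-sym p))
                        , (λ i j → esym G (a j i))

cliqueIrr : (G : Graph) (d : ℕ) → ∀ {S} → ¬ cliqueE G (suc d) S S
cliqueIrr G d (_ , a) = eirr G (a zero zero)

_/ₛ_ : Graph → ℕ → Graph
G /ₛ d = record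
  { V = Clique G (suc d) ; E = cliqueE G (suc d)
  ; esym = λ {S} {T} → cliqueSym G (suc d) {S} {T} ; eirr = λ {S} → cliqueIrr G d {S} }

record SemiringFamily (F : ℕ → Graph) : Set where
  field
    F0-empty : ¬ V (F 0)
    F1-nonempty : V (F 1)
    add : ∀ n m → F n ⊕ F m ⟶ F (n ℕ.+ m)
    mul : ∀ n m → F n ∗ F m ⟶ F (n ℕ.* m)

ℕ→ℚ : ℕ → ℚ
ℕ→ℚ n = + n / 1

_^ℚ_ : ℚ → ℕ → ℚ
q ^ℚ zero  = 1ℚ
q ^ℚ suc n = q ℚ.* (q ^ℚ n)

-- Each η(G) is a nonnegative real defined as the
-- infimum (resp. minimum) of a set S_η(G) of nonnegative reals.  Since
-- there are no reals, we represent η(G) by its rational upper set: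
--   Above η F G q  :⇔  some element s ∈ S_η(G) satisfies s ≤ q.
-- For every rational q, η(G) < q implies Above, and Above implies η(G) ≤ q.

data Param : Set where
  ηF ηFf ηF∞ : Param

Above : Param → (ℕ → Graph) → Graph → ℚ → Set
-- η_F(G) = min { n : G → F_n }
Above ηF  F G q = ∃ λ n → (G ⟶ F n) × (ℕ→ℚ n ℚ.≤ q)
-- η_{F,f}(G) = inf { n/d : G → F_n / d }, d ≥ 1 (d = suc d')
Above ηFf F G q = ∃ λ n → ∃ λ d' → (G ⟶ F n /ₛ d') × ((+ n / suc d') ℚ.≤ q)
-- η_{F,∞}(G) = inf_{m ≥ 1} η_F(G^{∗m})^{1/m}; for q ≥ 0,
-- η_F(G^{∗m})^{1/m} ≤ q  ⇔  ∃ k, G^{∗m} → F_k and k ≤ q^m.  (m = suc m')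
Above ηF∞ F G q = (0ℚ ℚ.≤ q) × ∃ λ m' → ∃ λ k →
                    (dpow G m' ⟶ F k) × (ℕ→ℚ k ℚ.≤ q ^ℚ suc m')

-- Real inequalities between such infima, expressed via upper sets:
--   η(X) ≤ η(Y)          ⇔  ∀ q, ε > 0, Above Y q → Above X (q + ε)
--   η(X) ≤ η(Y) + η(Z)   ⇔  ∀ q r, ε > 0, Above Y q → Above Z r → Above X (q + r + ε)
--   η(X) ≤ η(Y) · η(Z)   ⇔  ∀ q r, ε > 0, Above Y q → Above Z r → Above X (q · r + ε)
-- (valid since all these infima are of nonempty sets of nonnegative reals).

η≤ : Param → (ℕ → Graph) → Graph → Graph → Set
η≤ η F X Y = ∀ q ε → 0ℚ ℚ.< ε → Above η F Y q → Above η F X (q ℚ.+ ε)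

η≤+ : Param → (ℕ → Graph) → Graph → Graph → Graph → Set
η≤+ η F X Y Z = ∀ q r ε → 0ℚ ℚ.< ε → Above η F Y q → Above η F Z r →
                Above η F X (q ℚ.+ r ℚ.+ ε)

η≤* : Param → (ℕ → Graph) → Graph → Graph → Graph → Set
η≤* η F X Y Z = ∀ q r ε → 0ℚ ℚ.< ε → Above η F Y q → Above η F Z r →
                Above η F X (q ℚ.* r ℚ.+ ε)

{-# OPTIONS --safe #-}

-- For η_F the inequalities are immediate: homomorphisms G → F n and H → F m
-- combine, through the semiring maps of F, into G + H → F (n + m) and
-- G ∗ H → F (n m), and G ⋉ H → G ∗ H is the identity on vertices.  For
-- η_{F,f} one first brings n/(d+1) and m/(e+1) to the common denominator
-- (d+1)(e+1), pairing every clique with a fixed clique of F (e+1) (resp.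
-- F (d+1)); such cliques exist because F (e+1) receives the join of e+1
-- copies of F 1.  For η_{F,∞}, a single map G^{∗a} → F k with k ≤ qᵃ gives
-- maps G^{∗i} → F g with g ≤ C qⁱ for every i and a constant C.  Such bounds
-- multiply along ∗ and, by a binomial expansion of (G + H)^{∗n}, add along +;
-- finally (s + ε)ⁿ⁺¹ eventually exceeds C sⁿ⁺¹, so the constant is absorbed
-- by any ε > 0.

module Submission where

open import Defs
open import Data.Nat as ℕ using (ℕ; zero; suc)
import Data.Nat.Properties as ℕₚ
open import Data.Nat.DivMod using (m≡m%n+[m/n]*n; m%n<n)
open import Data.Fin using (Fin; zero; suc; remQuot; combine)
open import Data.Fin.Properties using (combine-remQuot) renaming (_≟_ to _≟ᶠ_)
open import Data.Integer as ℤ using (+_)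
import Data.Integer.Properties as ℤₚ
open import Data.Rational using (ℚ; mkℚ; _/_; 0ℚ; 1ℚ; _+_; _*_; _≤_; _<_; *<*; nonNegative; fromℚᵘ; toℚᵘ)
open import Data.Rational.Properties
import Data.Rational.Unnormalised as ℚᵘ
import Data.Rational.Unnormalised.Properties as ℚᵘₚ
open import Data.Rational.Solver using (module +-*-Solver)
open import Data.Product as Product using (∃; _×_; _,_; proj₁; proj₂; uncurry)
open import Data.Sum as Sum using (_⊎_; inj₁; inj₂)
open import Data.Unit using (⊤; tt)
open import Data.Empty using (⊥; ⊥-elim)
open import Relation.Nullary using (yes; no; contradiction)
open import Relation.Binary.PropositionalEquality

open +-*-Solver

-- Graph homomorphisms and products

infix 3 _⇒_
infixr 9 _∘ₕ_
infix 25 _∗^_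

record _⇒_ (X Y : Graph) : Set where
  constructor hom
  field
    fun  : V X → V Y
    edge : ∀ {x y} → E X x y → E Y (fun x) (fun y)
open _⇒_ public

toHom : ∀ {X Y} → X ⟶ Y → X ⇒ Y
toHom (f , f-edge) = hom f f-edge

fromHom : ∀ {X Y} → X ⇒ Y → X ⟶ Y
fromHom (hom f f-edge) = f , f-edge

idₕ : ∀ {X} → X ⇒ X
idₕ = hom (λ x → x) (λ e → e)

_∘ₕ_ : ∀ {X Y Z} → Y ⇒ Z → X ⇒ Y → X ⇒ Z
hom g g-edge ∘ₕ hom f f-edge = hom (λ x → g (f x)) (λ e → g-edge (f-edge e))

⊕-map : ∀ {X X′ Y Y′} → X ⇒ X′ → Y ⇒ Y′ → X ⊕ Y ⇒ X′ ⊕ Y′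
⊕-map {X} {X′} {Y} {Y′} f g = hom h (λ {u} {v} → h-edge {u} {v})
  where
  h : V X ⊎ V Y → V X′ ⊎ V Y′
  h = Sum.map (fun f) (fun g)
  h-edge : ∀ {u v} → joinE X Y u v → joinE X′ Y′ (h u) (h v)
  h-edge {inj₁ _} {inj₁ _} e = edge f e
  h-edge {inj₁ _} {inj₂ _} _ = tt
  h-edge {inj₂ _} {inj₁ _} _ = tt
  h-edge {inj₂ _} {inj₂ _} e = edge g e

∗-map : ∀ {X X′ Y Y′} → X ⇒ X′ → Y ⇒ Y′ → X ∗ Y ⇒ X′ ∗ Y′
∗-map f g = hom (Product.map (fun f) (fun g)) (Sum.map (edge f) (edge g))

∗-swap : ∀ {X Y} → X ∗ Y ⇒ Y ∗ X
∗-swap = hom Product.swap Sum.swap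

∗-assocˡ : ∀ {X Y Z} → X ∗ (Y ∗ Z) ⇒ (X ∗ Y) ∗ Z
∗-assocˡ = hom Product.assocˡ′ Sum.assocˡ

∗-assocʳ : ∀ {X Y Z} → (X ∗ Y) ∗ Z ⇒ X ∗ (Y ∗ Z)
∗-assocʳ = hom Product.assocʳ′ Sum.assocʳ

∗-exchange : ∀ {X Y Z} → X ∗ (Y ∗ Z) ⇒ Y ∗ (X ∗ Z)
∗-exchange = ∗-assocʳ ∘ₕ ∗-map ∗-swap idₕ ∘ₕ ∗-assocˡ

∗-interchange : ∀ {X Y Z W} → (X ∗ Y) ∗ (Z ∗ W) ⇒ (X ∗ Z) ∗ (Y ∗ W)
∗-interchange = ∗-assocˡ ∘ₕ ∗-map idₕ ∗-exchange ∘ₕ ∗-assocʳ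

∗-pairʳ : ∀ {X Y} → V Y → X ⇒ X ∗ Y
∗-pairʳ y = hom (_, y) inj₁

∗-pairˡ : ∀ {X Y} → V Y → X ⇒ Y ∗ X
∗-pairˡ y = hom (y ,_) inj₂

∗-distribʳ-⊕ : ∀ {X Y Z} → (X ⊕ Y) ∗ Z ⇒ (X ∗ Z) ⊕ (Y ∗ Z)
∗-distribʳ-⊕ {X} {Y} {Z} = hom h (λ {u} {v} → h-edge {u} {v})
  where
  h : (V X ⊎ V Y) × V Z → (V X × V Z) ⊎ (V Y × V Z)
  h (inj₁ x , z) = inj₁ (x , z)
  h (inj₂ y , z) = inj₂ (y , z)
  h-edge : ∀ {u v} → E ((X ⊕ Y) ∗ Z) u v → E ((X ∗ Z) ⊕ (Y ∗ Z)) (h u) (h v)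
  h-edge {inj₁ _ , _} {inj₁ _ , _} e = e
  h-edge {inj₁ _ , _} {inj₂ _ , _} _ = tt
  h-edge {inj₂ _ , _} {inj₁ _ , _} _ = tt
  h-edge {inj₂ _ , _} {inj₂ _ , _} e = e

⋉⇒∗ : ∀ {X Y} → X ⋉ Y ⇒ X ∗ Y
⋉⇒∗ = hom (λ v → v) (Sum.map₂ proj₂)

dpow-map : ∀ {X Y} m → X ⇒ Y → dpow X m ⇒ dpow Y m
dpow-map zero    f = f
dpow-map (suc m) f = ∗-map f (dpow-map m f)

diagonal : ∀ {X} m → X ⇒ dpow X m
diagonal zero    = idₕ
diagonal (suc m) = hom (λ x → x , fun (diagonal m) x) inj₁

K₁ : Graph
K₁ = record { V = ⊤ ; E = λ _ _ → ⊥ ; esym = λ () ; eirr = λ () }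

∗-unitˡ : ∀ {X} → K₁ ∗ X ⇒ X
∗-unitˡ = hom proj₂ Sum.[ (λ ()) , (λ e → e) ]

∗-unitʳ : ∀ {X} → X ∗ K₁ ⇒ X
∗-unitʳ = hom proj₁ Sum.[ (λ e → e) , (λ ()) ]

_∗^_ : Graph → ℕ → Graph
X ∗^ zero  = K₁
X ∗^ suc n = X ∗ X ∗^ n

∗^-map : ∀ {X Y} n → X ⇒ Y → X ∗^ n ⇒ Y ∗^ n
∗^-map zero    f = idₕ
∗^-map (suc n) f = ∗-map f (∗^-map n f)

∗^-+ : ∀ {X} a b → X ∗^ (a ℕ.+ b) ⇒ X ∗^ a ∗ X ∗^ b
∗^-+ zero    b = ∗-pairˡ tt
∗^-+ (suc a) b = ∗-assocˡ ∘ₕ ∗-map idₕ (∗^-+ a b)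

∗^-distrib-∗ : ∀ {X Y} n → (X ∗ Y) ∗^ n ⇒ X ∗^ n ∗ Y ∗^ n
∗^-distrib-∗ zero    = ∗-pairʳ tt
∗^-distrib-∗ (suc n) = ∗-interchange ∘ₕ ∗-map idₕ (∗^-distrib-∗ n)

dpow⇒∗^ : ∀ {X} m → dpow X m ⇒ X ∗^ suc m
dpow⇒∗^ zero    = ∗-pairʳ tt
dpow⇒∗^ (suc m) = ∗-map idₕ (dpow⇒∗^ m)

∗^⇒dpow : ∀ {X} m → X ∗^ suc m ⇒ dpow X m
∗^⇒dpow zero    = ∗-unitʳ
∗^⇒dpow (suc m) = ∗-map idₕ (∗^⇒dpow m)

-- Clique graphs

adjacent⇒cliqueE : ∀ {X d} (S T : Clique X d) →
                   (∀ i j → E X (elt S i) (elt T j)) → cliqueE X d S T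
adjacent⇒cliqueE {X} S T adj =
  (λ i j Sᵢ≡Tⱼ → eirr X (subst (λ x → E X x (elt T j)) Sᵢ≡Tⱼ (adj i j))) , adj

Clique-map : ∀ {X Y d} → X ⇒ Y → Clique X d → Clique Y d
Clique-map f S = record { elt = λ i → fun f (elt S i) ; adj = λ i j i≢j → edge f (adj S i j i≢j) }

/-map : ∀ {X Y} d → X ⇒ Y → X /ₛ d ⇒ Y /ₛ d
/-map d f = hom (Clique-map f) λ {S} {T} S~T →
  adjacent⇒cliqueE (Clique-map f S) (Clique-map f T) (λ i j → edge f (proj₂ S~T i j))

/-⊕ : ∀ {X Y} d → (X /ₛ d) ⊕ (Y /ₛ d) ⇒ (X ⊕ Y) /ₛ d
/-⊕ {X} {Y} d = hom h (λ {u} {v} → h-edge {u} {v})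
  where
  h : Clique X (suc d) ⊎ Clique Y (suc d) → Clique (X ⊕ Y) (suc d)
  h (inj₁ S) = Clique-map (hom inj₁ (λ e → e)) S
  h (inj₂ T) = Clique-map (hom inj₂ (λ e → e)) T
  h-edge : ∀ {u v} → E ((X /ₛ d) ⊕ (Y /ₛ d)) u v → E ((X ⊕ Y) /ₛ d) (h u) (h v)
  h-edge {inj₁ S} {inj₁ S′} e = adjacent⇒cliqueE (h (inj₁ S)) (h (inj₁ S′)) (proj₂ e)
  h-edge {inj₁ S} {inj₂ T}  _ = adjacent⇒cliqueE (h (inj₁ S)) (h (inj₂ T)) (λ _ _ → tt)
  h-edge {inj₂ T} {inj₁ S}  _ = adjacent⇒cliqueE (h (inj₂ T)) (h (inj₁ S)) (λ _ _ → tt)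
  h-edge {inj₂ T} {inj₂ T′} e = adjacent⇒cliqueE (h (inj₂ T)) (h (inj₂ T′)) (proj₂ e)

remQuot-injective : ∀ {m} n (i j : Fin (m ℕ.* n)) → remQuot {m} n i ≡ remQuot {m} n j → i ≡ j
remQuot-injective {m} n i j eq = begin
  i                                 ≡⟨ combine-remQuot {m} n i ⟨
  uncurry combine (remQuot {m} n i) ≡⟨ cong (uncurry combine) eq ⟩
  uncurry combine (remQuot {m} n j) ≡⟨ combine-remQuot {m} n j ⟩
  j                                 ∎
  where open ≡-Reasoning

Clique-∗ : ∀ {X Y d e} → Clique X (suc d) → Clique Y (suc e) → Clique (X ∗ Y) (suc d ℕ.* suc e)
Clique-∗ {X} {Y} {d} {e} S T = record { elt = el ; adj = el-adj }
  where
  coords : Fin (suc d ℕ.* suc e) → Fin (suc d) × Fin (suc e)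
  coords = remQuot {suc d} (suc e)
  el : Fin (suc d ℕ.* suc e) → V X × V Y
  el k = elt S (proj₁ (coords k)) , elt T (proj₂ (coords k))
  el-adj : ∀ i j → i ≢ j → E (X ∗ Y) (el i) (el j)
  el-adj i j i≢j with proj₁ (coords i) ≟ᶠ proj₁ (coords j) | proj₂ (coords i) ≟ᶠ proj₂ (coords j)
  ... | no  ≢₁ | _       = inj₁ (adj S _ _ ≢₁)
  ... | yes _  | no  ≢₂  = inj₂ (adj T _ _ ≢₂)
  ... | yes ≡₁ | yes ≡₂  = ⊥-elim (i≢j (remQuot-injective (suc e) i j (cong₂ _,_ ≡₁ ≡₂)))

-- (d+1)(e+1) = suc (e + d (e+1)), in the size offset of _/ₛ_.
/-∗ : ∀ {X Y} d e → (X /ₛ d) ∗ (Y /ₛ e) ⇒ (X ∗ Y) /ₛ (e ℕ.+ d ℕ.* suc e)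
/-∗ d e = hom (uncurry Clique-∗) λ {u} {v} u~v →
  adjacent⇒cliqueE (uncurry Clique-∗ u) (uncurry Clique-∗ v)
    (λ _ _ → Sum.map (λ S~S′ → proj₂ S~S′ _ _) (λ T~T′ → proj₂ T~T′ _ _) u~v)

-- Rational arithmetic

-- Identities between fractions + n / suc d are proved in ℚᵘ, where no gcd
-- normalisation happens and fromℚᵘ (mkℚᵘ (+ n) d) is + n / suc d by definition.
fromℚᵘ-homo-+ : ∀ p q → fromℚᵘ (p ℚᵘ.+ q) ≡ fromℚᵘ p + fromℚᵘ q
fromℚᵘ-homo-+ p q = toℚᵘ-injective (ℚᵘₚ.≃-trans (toℚᵘ-fromℚᵘ (p ℚᵘ.+ q))
  (ℚᵘₚ.≃-sym (ℚᵘₚ.≃-trans (toℚᵘ-homo-+ (fromℚᵘ p) (fromℚᵘ q)) (ℚᵘₚ.+-cong (toℚᵘ-fromℚᵘ p) (toℚᵘ-fromℚᵘ q)))))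

fromℚᵘ-homo-* : ∀ p q → fromℚᵘ (p ℚᵘ.* q) ≡ fromℚᵘ p * fromℚᵘ q
fromℚᵘ-homo-* p q = toℚᵘ-injective (ℚᵘₚ.≃-trans (toℚᵘ-fromℚᵘ (p ℚᵘ.* q))
  (ℚᵘₚ.≃-sym (ℚᵘₚ.≃-trans (toℚᵘ-homo-* (fromℚᵘ p) (fromℚᵘ q)) (ℚᵘₚ.*-cong (toℚᵘ-fromℚᵘ p) (toℚᵘ-fromℚᵘ q)))))

ℕ/-+ : ∀ n m d e → (+ n / suc d) + (+ m / suc e) ≡ + (n ℕ.* suc e ℕ.+ suc d ℕ.* m) / (suc d ℕ.* suc e)
ℕ/-+ n m d e = begin
  (+ n / suc d) + (+ m / suc e)                      ≡⟨ fromℚᵘ-homo-+ (ℚᵘ.mkℚᵘ (+ n) d) (ℚᵘ.mkℚᵘ (+ m) e) ⟨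
  fromℚᵘ (ℚᵘ.mkℚᵘ (+ n) d ℚᵘ.+ ℚᵘ.mkℚᵘ (+ m) e)     ≡⟨ fromℚᵘ-cong sum≃ ⟩
  + (n ℕ.* suc e ℕ.+ suc d ℕ.* m) / (suc d ℕ.* suc e) ∎
  where
  open ≡-Reasoning
  numerators : + (n ℕ.* suc e ℕ.+ suc d ℕ.* m) ≡ + n ℤ.* + suc e ℤ.+ + m ℤ.* + suc d
  numerators = begin
    + (n ℕ.* suc e ℕ.+ suc d ℕ.* m)      ≡⟨ ℤₚ.pos-+ (n ℕ.* suc e) (suc d ℕ.* m) ⟩
    + (n ℕ.* suc e) ℤ.+ + (suc d ℕ.* m)  ≡⟨ cong₂ ℤ._+_ (ℤₚ.pos-* n (suc e)) (ℤₚ.pos-* (suc d) m) ⟩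
    + n ℤ.* + suc e ℤ.+ + suc d ℤ.* + m  ≡⟨ cong (ℤ._+_ (+ n ℤ.* + suc e)) (ℤₚ.*-comm (+ suc d) (+ m)) ⟩
    + n ℤ.* + suc e ℤ.+ + m ℤ.* + suc d  ∎
  sum≃ : ℚᵘ.mkℚᵘ (+ n) d ℚᵘ.+ ℚᵘ.mkℚᵘ (+ m) e ℚᵘ.≃ ℚᵘ.mkℚᵘ (+ (n ℕ.* suc e ℕ.+ suc d ℕ.* m)) (e ℕ.+ d ℕ.* suc e)
  sum≃ = ℚᵘ.*≡* (cong (ℤ._* + (suc d ℕ.* suc e)) (sym numerators))

ℕ/-* : ∀ n m d e → (+ n / suc d) * (+ m / suc e) ≡ + (n ℕ.* m) / (suc d ℕ.* suc e)
ℕ/-* n m d e = begin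
  (+ n / suc d) * (+ m / suc e)                  ≡⟨ fromℚᵘ-homo-* (ℚᵘ.mkℚᵘ (+ n) d) (ℚᵘ.mkℚᵘ (+ m) e) ⟨
  fromℚᵘ (ℚᵘ.mkℚᵘ (+ n) d ℚᵘ.* ℚᵘ.mkℚᵘ (+ m) e) ≡⟨ fromℚᵘ-cong product≃ ⟩
  + (n ℕ.* m) / (suc d ℕ.* suc e)                ∎
  where
  open ≡-Reasoning
  product≃ : ℚᵘ.mkℚᵘ (+ n) d ℚᵘ.* ℚᵘ.mkℚᵘ (+ m) e ℚᵘ.≃ ℚᵘ.mkℚᵘ (+ (n ℕ.* m)) (e ℕ.+ d ℕ.* suc e)
  product≃ = ℚᵘ.*≡* (cong (ℤ._* + (suc d ℕ.* suc e)) (sym (ℤₚ.pos-* n m)))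

ℕ→ℚ-+ : ∀ m n → ℕ→ℚ (m ℕ.+ n) ≡ ℕ→ℚ m + ℕ→ℚ n
ℕ→ℚ-+ m n = begin
  ℕ→ℚ (m ℕ.+ n)                 ≡⟨ cong₂ (λ a b → + (a ℕ.+ b) / 1) (ℕₚ.*-identityʳ m) (ℕₚ.+-identityʳ n) ⟨
  + (m ℕ.* 1 ℕ.+ 1 ℕ.* n) / 1   ≡⟨ ℕ/-+ m n 0 0 ⟨
  ℕ→ℚ m + ℕ→ℚ n                 ∎
  where open ≡-Reasoning

ℕ→ℚ-* : ∀ m n → ℕ→ℚ (m ℕ.* n) ≡ ℕ→ℚ m * ℕ→ℚ n
ℕ→ℚ-* m n = sym (ℕ/-* m n 0 0)

0≤ℕ/ : ∀ n d → 0ℚ ≤ + n / suc d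
0≤ℕ/ n d = nonNegative⁻¹ (+ n / suc d) {{normalize-nonNeg n (suc d)}}

0≤ℕ→ℚ : ∀ n → 0ℚ ≤ ℕ→ℚ n
0≤ℕ→ℚ n = 0≤ℕ/ n 0

0≤+ : ∀ {p q} → 0ℚ ≤ p → 0ℚ ≤ q → 0ℚ ≤ p + q
0≤+ {p} {q} 0≤p 0≤q = nonNegative⁻¹ (p + q) {{nonNeg+nonNeg⇒nonNeg p {{nonNegative 0≤p}} q {{nonNegative 0≤q}}}}

0≤* : ∀ {p q} → 0ℚ ≤ p → 0ℚ ≤ q → 0ℚ ≤ p * q
0≤* {p} {q} 0≤p 0≤q = nonNegative⁻¹ (p * q) {{nonNeg*nonNeg⇒nonNeg p {{nonNegative 0≤p}} q {{nonNegative 0≤q}}}}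

*-mono-≤-nonNeg : ∀ {p q r s} → 0ℚ ≤ p → 0ℚ ≤ r → p ≤ q → r ≤ s → p * r ≤ q * s
*-mono-≤-nonNeg {p} {q} {r} {s} 0≤p 0≤r p≤q r≤s =
  ≤-trans (*-monoʳ-≤-nonNeg r {{nonNegative 0≤r}} p≤q) (*-monoˡ-≤-nonNeg q {{nonNegative (≤-trans 0≤p p≤q)}} r≤s)

p≤p+q : ∀ {p q} → 0ℚ ≤ q → p ≤ p + q
p≤p+q {p} 0≤q = subst (_≤ p + _) (+-identityʳ p) (+-monoʳ-≤ p 0≤q)

ℕ→ℚ-mono-≤ : ∀ {m n} → m ℕ.≤ n → ℕ→ℚ m ≤ ℕ→ℚ n
ℕ→ℚ-mono-≤ {m} {n} m≤n = subst (λ k → ℕ→ℚ m ≤ ℕ→ℚ k) (ℕₚ.m+[n∸m]≡n m≤n)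
  (subst (ℕ→ℚ m ≤_) (sym (ℕ→ℚ-+ m (n ℕ.∸ m))) (p≤p+q (0≤ℕ→ℚ (n ℕ.∸ m))))

0≤^ℚ : ∀ {q} n → 0ℚ ≤ q → 0ℚ ≤ q ^ℚ n
0≤^ℚ zero    0≤q = 0≤ℕ→ℚ 1
0≤^ℚ (suc n) 0≤q = 0≤* 0≤q (0≤^ℚ n 0≤q)

^ℚ-monoˡ-≤ : ∀ {p q} n → 0ℚ ≤ p → p ≤ q → p ^ℚ n ≤ q ^ℚ n
^ℚ-monoˡ-≤ zero    0≤p p≤q = ≤-refl
^ℚ-monoˡ-≤ (suc n) 0≤p p≤q = *-mono-≤-nonNeg 0≤p (0≤^ℚ n 0≤p) p≤q (^ℚ-monoˡ-≤ n 0≤p p≤q)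

^ℚ-distribˡ-+-* : ∀ q m n → q ^ℚ (m ℕ.+ n) ≡ q ^ℚ m * q ^ℚ n
^ℚ-distribˡ-+-* q zero    n = sym (*-identityˡ _)
^ℚ-distribˡ-+-* q (suc m) n = trans (cong (q *_) (^ℚ-distribˡ-+-* q m n)) (sym (*-assoc q _ _))

^ℚ-distribʳ-* : ∀ p q n → (p * q) ^ℚ n ≡ p ^ℚ n * q ^ℚ n
^ℚ-distribʳ-* p q zero    = refl
^ℚ-distribʳ-* p q (suc n) = trans (cong ((p * q) *_) (^ℚ-distribʳ-* p q n))
  (solve 4 (λ a b c d → (a :* b) :* (c :* d) := (a :* c) :* (b :* d)) refl p q (p ^ℚ n) (q ^ℚ n))

1^ℚ : ∀ n → 1ℚ ^ℚ n ≡ 1ℚ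
1^ℚ zero    = refl
1^ℚ (suc n) = trans (*-identityˡ _) (1^ℚ n)

1≤^ℚ : ∀ {q} n → 1ℚ ≤ q → 1ℚ ≤ q ^ℚ n
1≤^ℚ {q} n 1≤q = subst (_≤ q ^ℚ n) (1^ℚ n) (^ℚ-monoˡ-≤ n (0≤ℕ→ℚ 1) 1≤q)

^ℚ<1 : ∀ {q} n → 0ℚ ≤ q → q < 1ℚ → q ^ℚ suc n < 1ℚ
^ℚ<1 {q} n 0≤q q<1 = begin-strict
  q * q ^ℚ n ≤⟨ *-monoˡ-≤-nonNeg q {{nonNegative 0≤q}} (subst (q ^ℚ n ≤_) (1^ℚ n) (^ℚ-monoˡ-≤ n 0≤q (<⇒≤ q<1))) ⟩
  q * 1ℚ     ≡⟨ *-identityʳ q ⟩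
  q          <⟨ q<1 ⟩
  1ℚ         ∎
  where open ≤-Reasoning

1≤^ℚ⇒1≤ : ∀ {q} n → 0ℚ ≤ q → 1ℚ ≤ q ^ℚ suc n → 1ℚ ≤ q
1≤^ℚ⇒1≤ {q} n 0≤q 1≤qⁿ⁺¹ with q <? 1ℚ
... | no  q≮1 = ≮⇒≥ q≮1
... | yes q<1 = contradiction (≤-<-trans 1≤qⁿ⁺¹ (^ℚ<1 n 0≤q q<1)) (<-irrefl refl)

linear-term≤^ℚ : ∀ {s ε} m → 0ℚ ≤ s → 0ℚ ≤ ε → ℕ→ℚ (suc m) * ε * s ^ℚ m ≤ (s + ε) ^ℚ suc m
linear-term≤^ℚ {s} {ε} zero 0≤s 0≤ε = begin
  1ℚ * ε * 1ℚ       ≡⟨ solve 1 (λ ε → con 1ℚ :* ε :* con 1ℚ := ε) refl ε ⟩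
  ε                 ≤⟨ subst (ε ≤_) (+-comm ε s) (p≤p+q 0≤s) ⟩
  s + ε             ≡⟨ *-identityʳ (s + ε) ⟨
  (s + ε) * 1ℚ      ∎
  where open ≤-Reasoning
linear-term≤^ℚ {s} {ε} (suc m) 0≤s 0≤ε = begin
  ℕ→ℚ (suc (suc m)) * ε * (s * sᵐ)                 ≡⟨ cong (λ c → c * ε * (s * sᵐ)) (ℕ→ℚ-+ 1 (suc m)) ⟩
  (1ℚ + ℕ→ℚ (suc m)) * ε * (s * sᵐ)                ≡⟨ solve 4 (λ c ε s t → (con 1ℚ :+ c) :* ε :* (s :* t) := s :* (c :* ε :* t) :+ ε :* (s :* t)) refl (ℕ→ℚ (suc m)) ε s sᵐ ⟩
  s * (ℕ→ℚ (suc m) * ε * sᵐ) + ε * (s * sᵐ)        ≤⟨ +-mono-≤ (*-monoˡ-≤-nonNeg s {{nonNegative 0≤s}} (linear-term≤^ℚ m 0≤s 0≤ε))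
                                                                (*-monoˡ-≤-nonNeg ε {{nonNegative 0≤ε}} (^ℚ-monoˡ-≤ (suc m) 0≤s (p≤p+q 0≤ε))) ⟩
  s * (s + ε) ^ℚ suc m + ε * (s + ε) ^ℚ suc m      ≡⟨ *-distribʳ-+ ((s + ε) ^ℚ suc m) s ε ⟨
  (s + ε) ^ℚ suc (suc m)                           ∎
  where
  open ≤-Reasoning
  sᵐ = s ^ℚ m

i≤+∣i∣ : ∀ i → i ℤ.≤ + ℤ.∣ i ∣
i≤+∣i∣ (+ n)      = ℤₚ.≤-refl
i≤+∣i∣ ℤ.-[1+ n ] = ℤ.-≤+

-- For p = i/(a+1) and ε = (k+1)/(b+1), the witness N = ∣i∣ (b+1) works.
archimedean : ∀ p ε → 0ℚ < ε → ∃ λ N → p ≤ ℕ→ℚ N * ε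
archimedean (mkℚ i a _) (mkℚ (+ 0)      b _) (*<* (ℤ.+<+ ()))
archimedean (mkℚ i a _) (mkℚ ℤ.-[1+ k ] b _) (*<* ())
archimedean p@(mkℚ i a _) ε@(mkℚ ℤ.+[1+ k ] b _) _ =
  N , toℚᵘ-cancel-≤ (ℚᵘₚ.≤-respʳ-≃ (ℚᵘₚ.≃-sym Nε≃) (ℚᵘ.*≤* cross-multiplied))
  where
  N = ℤ.∣ i ∣ ℕ.* suc b
  Nε≃ : toℚᵘ (ℕ→ℚ N * ε) ℚᵘ.≃ ℚᵘ.mkℚᵘ (+ N) 0 ℚᵘ.* ℚᵘ.mkℚᵘ ℤ.+[1+ k ] b
  Nε≃ = ℚᵘₚ.≃-trans (toℚᵘ-homo-* (ℕ→ℚ N) ε) (ℚᵘₚ.*-cong (toℚᵘ-fromℚᵘ (ℚᵘ.mkℚᵘ (+ N) 0)) ℚᵘₚ.≃-refl)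
  ∣i∣b≤Nka : ℤ.∣ i ∣ ℕ.* (suc b ℕ.+ 0) ℕ.≤ N ℕ.* suc k ℕ.* suc a
  ∣i∣b≤Nka = ℕₚ.≤-trans (ℕₚ.≤-reflexive (cong (ℤ.∣ i ∣ ℕ.*_) (ℕₚ.+-identityʳ (suc b))))
                        (ℕₚ.≤-trans (ℕₚ.m≤m*n N (suc k)) (ℕₚ.m≤m*n (N ℕ.* suc k) (suc a)))
  cross-multiplied : i ℤ.* + (suc b ℕ.+ 0) ℤ.≤ (+ N ℤ.* + suc k) ℤ.* + suc a
  cross-multiplied = ℤₚ.≤-trans (ℤₚ.*-monoʳ-≤-nonNeg (+ (suc b ℕ.+ 0)) (i≤+∣i∣ i))
    (subst₂ ℤ._≤_ (ℤₚ.pos-* ℤ.∣ i ∣ (suc b ℕ.+ 0))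
                  (trans (ℤₚ.pos-* (N ℕ.* suc k) (suc a)) (cong (ℤ._* + suc a) (ℤₚ.pos-* N (suc k))))
                  (ℤ.+≤+ ∣i∣b≤Nka))

^ℚ-outgrows-constant : ∀ C s ε → 0ℚ ≤ C → 0ℚ ≤ s → 0ℚ < ε → ∃ λ m → C * s ^ℚ suc m ≤ (s + ε) ^ℚ suc m
^ℚ-outgrows-constant C s ε 0≤C 0≤s 0<ε with archimedean (C * s) ε 0<ε
... | N , Cs≤Nε = N , (begin
  C * (s * s ^ℚ N)              ≡⟨ *-assoc C s (s ^ℚ N) ⟨
  C * s * s ^ℚ N                ≤⟨ *-monoʳ-≤-nonNeg (s ^ℚ N) {{nonNegative (0≤^ℚ N 0≤s)}} Cs≤Nε ⟩
  ℕ→ℚ N * ε * s ^ℚ N            ≤⟨ *-monoʳ-≤-nonNeg (s ^ℚ N) {{nonNegative (0≤^ℚ N 0≤s)}}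
                                     (*-monoʳ-≤-nonNeg ε {{nonNegative (<⇒≤ 0<ε)}} (ℕ→ℚ-mono-≤ (ℕₚ.n≤1+n N))) ⟩
  ℕ→ℚ (suc N) * ε * s ^ℚ N      ≤⟨ linear-term≤^ℚ N 0≤s (<⇒≤ 0<ε) ⟩
  (s + ε) ^ℚ suc N              ∎)
  where open ≤-Reasoning

ℕ→ℚ-*-mono-≤ : ∀ m n {p q} → ℕ→ℚ m ≤ p → ℕ→ℚ n ≤ q → ℕ→ℚ (m ℕ.* n) ≤ p * q
ℕ→ℚ-*-mono-≤ m n m≤p n≤q =
  subst (_≤ _) (sym (ℕ→ℚ-* m n)) (*-mono-≤-nonNeg (0≤ℕ→ℚ m) (0≤ℕ→ℚ n) m≤p n≤q)

k^r≤[1+kᵃ]qʳ : ∀ {q} k a r → 0ℚ ≤ q → r ℕ.≤ suc a → ℕ→ℚ k ≤ q ^ℚ suc a →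
               ℕ→ℚ (k ℕ.^ r) ≤ ℕ→ℚ (1 ℕ.+ k ℕ.^ suc a) * q ^ℚ r
k^r≤[1+kᵃ]qʳ zero      a zero    0≤q _ _ = ≤-reflexive (sym (*-identityʳ 1ℚ))
k^r≤[1+kᵃ]qʳ zero      a (suc r) 0≤q _ _ = 0≤* (0≤ℕ→ℚ 1) (0≤^ℚ (suc r) 0≤q)
k^r≤[1+kᵃ]qʳ {q} k@(suc _) a r 0≤q r≤a k≤qᵃ = begin
  ℕ→ℚ (k ℕ.^ r) ≤⟨ ℕ→ℚ-mono-≤ (ℕₚ.m≤n⇒m≤1+n (ℕₚ.^-monoʳ-≤ k r≤a)) ⟩
  C             ≡⟨ *-identityʳ C ⟨
  C * 1ℚ        ≤⟨ *-monoˡ-≤-nonNeg C {{nonNegative (0≤ℕ→ℚ (1 ℕ.+ k ℕ.^ suc a))}} (1≤^ℚ r 1≤q) ⟩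
  C * q ^ℚ r    ∎
  where
  open ≤-Reasoning
  C = ℕ→ℚ (1 ℕ.+ k ℕ.^ suc a)
  1≤q : 1ℚ ≤ q
  1≤q = 1≤^ℚ⇒1≤ a 0≤q (≤-trans (ℕ→ℚ-mono-≤ {1} {k} (ℕ.s≤s ℕ.z≤n)) k≤qᵃ)

-- The three parameters

module _ (F : ℕ → Graph) where

  Above-antitone : ∀ η {X Y q} → X ⇒ Y → Above η F Y q → Above η F X q
  Above-antitone ηF  {X} {Y} f (n , g , n≤q) = n , fromHom (toHom {Y} {F n} g ∘ₕ f) , n≤q
  Above-antitone ηFf {X} {Y} f (n , d , g , n/d≤q) = n , d , fromHom (toHom {Y} {F n /ₛ d} g ∘ₕ f) , n/d≤q
  Above-antitone ηF∞ {X} {Y} f (0≤q , m , k , g , k≤qᵐ) =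
    0≤q , m , k , fromHom (toHom {dpow Y m} {F k} g ∘ₕ dpow-map m f) , k≤qᵐ

  Above-mono : ∀ η {X q q′} → q ≤ q′ → Above η F X q → Above η F X q′
  Above-mono ηF  q≤q′ (n , g , n≤q) = n , g , ≤-trans n≤q q≤q′
  Above-mono ηFf q≤q′ (n , d , g , n/d≤q) = n , d , g , ≤-trans n/d≤q q≤q′
  Above-mono ηF∞ q≤q′ (0≤q , m , k , g , k≤qᵐ) =
    ≤-trans 0≤q q≤q′ , m , k , g , ≤-trans k≤qᵐ (^ℚ-monoˡ-≤ (suc m) 0≤q q≤q′)

module _ {F : ℕ → Graph} (sf : SemiringFamily F) where
  open SemiringFamily sf

  addₕ : ∀ n m → F n ⊕ F m ⇒ F (n ℕ.+ m)
  addₕ n m = toHom (add n m)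

  mulₕ : ∀ n m → F n ∗ F m ⇒ F (n ℕ.* m)
  mulₕ n m = toHom (mul n m)

  F-clique : ∀ e → Clique (F e) e
  F-clique zero    = record { elt = λ () ; adj = λ () }
  F-clique (suc e) = record { elt = el ; adj = el-adj }
    where
    el : Fin (suc e) → V (F (suc e))
    el zero    = fun (addₕ 1 e) (inj₁ F1-nonempty)
    el (suc i) = fun (addₕ 1 e) (inj₂ (elt (F-clique e) i))
    el-adj : ∀ i j → i ≢ j → E (F (suc e)) (el i) (el j)
    el-adj zero    zero    i≢j = ⊥-elim (i≢j refl)
    el-adj zero    (suc j) _   = edge (addₕ 1 e) {inj₁ F1-nonempty} {inj₂ _} tt
    el-adj (suc i) zero    _   = edge (addₕ 1 e) {inj₂ _} {inj₁ F1-nonempty} tt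
    el-adj (suc i) (suc j) i≢j = edge (addₕ 1 e) {inj₂ _} {inj₂ _} (adj (F-clique e) i j (λ i≡j → i≢j (cong suc i≡j)))

  F-power : ∀ k t → F k ∗^ t ⇒ F (k ℕ.^ t)
  F-power k zero    = hom (λ _ → F1-nonempty) (λ ())
  F-power k (suc t) = mulₕ k (k ℕ.^ t) ∘ₕ ∗-map idₕ (F-power k t)

  /-rescaleʳ : ∀ n d e → F n /ₛ d ⇒ F (n ℕ.* suc e) /ₛ (e ℕ.+ d ℕ.* suc e)
  /-rescaleʳ n d e = /-map _ (mulₕ n (suc e)) ∘ₕ /-∗ d e ∘ₕ ∗-pairʳ {Y = F (suc e) /ₛ e} (F-clique (suc e))

  /-rescaleˡ : ∀ m d e → F m /ₛ e ⇒ F (suc d ℕ.* m) /ₛ (e ℕ.+ d ℕ.* suc e)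
  /-rescaleˡ m d e = /-map _ (mulₕ (suc d) m) ∘ₕ /-∗ d e ∘ₕ ∗-pairˡ {Y = F (suc d) /ₛ d} (F-clique (suc d))

  Above-ηF-⊕ : ∀ {X Y q r} → Above ηF F X q → Above ηF F Y r → Above ηF F (X ⊕ Y) (q + r)
  Above-ηF-⊕ {X} {Y} (n , f , n≤q) (m , g , m≤r) =
    n ℕ.+ m , fromHom (addₕ n m ∘ₕ ⊕-map (toHom {X} {F n} f) (toHom {Y} {F m} g)) ,
    subst (_≤ _) (sym (ℕ→ℚ-+ n m)) (+-mono-≤ n≤q m≤r)

  Above-ηF-∗ : ∀ {X Y q r} → Above ηF F X q → Above ηF F Y r → Above ηF F (X ∗ Y) (q * r)
  Above-ηF-∗ {X} {Y} (n , f , n≤q) (m , g , m≤r) =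
    n ℕ.* m , fromHom (mulₕ n m ∘ₕ ∗-map (toHom {X} {F n} f) (toHom {Y} {F m} g)) ,
    ℕ→ℚ-*-mono-≤ n m n≤q m≤r

  Above-ηFf-⊕ : ∀ {X Y q r} → Above ηFf F X q → Above ηFf F Y r → Above ηFf F (X ⊕ Y) (q + r)
  Above-ηFf-⊕ {X} {Y} (n , d , f , n/d≤q) (m , e , g , m/e≤r) =
    n ℕ.* suc e ℕ.+ suc d ℕ.* m , e ℕ.+ d ℕ.* suc e ,
    fromHom (/-map D (addₕ _ _) ∘ₕ /-⊕ D ∘ₕ ⊕-map (/-rescaleʳ n d e ∘ₕ toHom {X} {F n /ₛ d} f)
                                                  (/-rescaleˡ m d e ∘ₕ toHom {Y} {F m /ₛ e} g)) ,
    subst (_≤ _) (ℕ/-+ n m d e) (+-mono-≤ n/d≤q m/e≤r)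
    where D = e ℕ.+ d ℕ.* suc e

  Above-ηFf-∗ : ∀ {X Y q r} → Above ηFf F X q → Above ηFf F Y r → Above ηFf F (X ∗ Y) (q * r)
  Above-ηFf-∗ {X} {Y} (n , d , f , n/d≤q) (m , e , g , m/e≤r) =
    n ℕ.* m , e ℕ.+ d ℕ.* suc e ,
    fromHom (/-map _ (mulₕ n m) ∘ₕ /-∗ d e ∘ₕ ∗-map (toHom {X} {F n /ₛ d} f) (toHom {Y} {F m /ₛ e} g)) ,
    subst (_≤ _) (ℕ/-* n m d e) (*-mono-≤-nonNeg (0≤ℕ/ n d) (0≤ℕ/ m e) n/d≤q m/e≤r)

  record PowerBound (X : Graph) (q : ℚ) : Set where
    field
      C     : ℚ
      0≤C   : 0ℚ ≤ C
      bound : ∀ i → ∃ λ g → (X ∗^ i ⇒ F g) × (ℕ→ℚ g ≤ C * q ^ℚ i)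

  Above⇒PowerBound : ∀ {X q} → Above ηF∞ F X q → PowerBound X q
  Above⇒PowerBound {X} {q} (0≤q , a′ , k , f , k≤qᵃ) = record { C = C ; 0≤C = 0≤ℕ→ℚ (1 ℕ.+ k ℕ.^ a) ; bound = bounded }
    where
    a = suc a′
    C = ℕ→ℚ (1 ℕ.+ k ℕ.^ a)
    Bounded : ℕ → Set
    Bounded i = ∃ λ g → (X ∗^ i ⇒ F g) × (ℕ→ℚ g ≤ C * q ^ℚ i)
    fₕ : dpow X a′ ⇒ F k
    fₕ = toHom {dpow X a′} {F k} f
    -- Write i = t a + r with r < a: the part X^{∗ta} goes through f, the
    -- remainder X^{∗r} through the diagonal X → X^{∗a} at a cost k^r ≤ 1 + kᵃ.
    bounded-below : ∀ r → r ℕ.< a → Bounded r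
    bounded-below r r<a = k ℕ.^ r , F-power k r ∘ₕ ∗^-map r (fₕ ∘ₕ diagonal a′) ,
                          k^r≤[1+kᵃ]qʳ k a′ r 0≤q (ℕₚ.<⇒≤ r<a) k≤qᵃ
    bounded-step : ∀ i → Bounded i → Bounded (a ℕ.+ i)
    bounded-step i (g , φ , g≤) = k ℕ.* g , mulₕ k g ∘ₕ ∗-map (fₕ ∘ₕ ∗^⇒dpow a′) φ ∘ₕ ∗^-+ a i , (begin
      ℕ→ℚ (k ℕ.* g)               ≤⟨ ℕ→ℚ-*-mono-≤ k g k≤qᵃ g≤ ⟩
      q ^ℚ a * (C * q ^ℚ i)       ≡⟨ solve 3 (λ x y z → x :* (y :* z) := y :* (x :* z)) refl (q ^ℚ a) C (q ^ℚ i) ⟩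
      C * (q ^ℚ a * q ^ℚ i)       ≡⟨ cong (C *_) (^ℚ-distribˡ-+-* q a i) ⟨
      C * q ^ℚ (a ℕ.+ i)          ∎)
      where open ≤-Reasoning
    bounded-multiple : ∀ t r → r ℕ.< a → Bounded (t ℕ.* a ℕ.+ r)
    bounded-multiple zero    r r<a = bounded-below r r<a
    bounded-multiple (suc t) r r<a =
      subst Bounded (sym (ℕₚ.+-assoc a (t ℕ.* a) r)) (bounded-step _ (bounded-multiple t r r<a))
    bounded : ∀ i → Bounded i
    bounded i = subst Bounded (sym (trans (m≡m%n+[m/n]*n i a) (ℕₚ.+-comm (i ℕ.% a) _)))
                              (bounded-multiple (i ℕ./ a) (i ℕ.% a) (m%n<n i a))

  PowerBound-∗ : ∀ {X Y q r} → PowerBound X q → PowerBound Y r → PowerBound (X ∗ Y) (q * r)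
  PowerBound-∗ {X} {Y} {q} {r} B₁ B₂ = record { C = C₁ * C₂ ; 0≤C = 0≤* 0≤C₁ 0≤C₂ ; bound = bounded }
    where
    open PowerBound B₁ renaming (C to C₁; 0≤C to 0≤C₁; bound to bound₁)
    open PowerBound B₂ renaming (C to C₂; 0≤C to 0≤C₂; bound to bound₂)
    bounded : ∀ i → ∃ λ g → ((X ∗ Y) ∗^ i ⇒ F g) × (ℕ→ℚ g ≤ C₁ * C₂ * (q * r) ^ℚ i)
    bounded i with bound₁ i | bound₂ i
    ... | g , φ , g≤ | h , ψ , h≤ = g ℕ.* h , mulₕ g h ∘ₕ ∗-map φ ψ ∘ₕ ∗^-distrib-∗ i , (begin
      ℕ→ℚ (g ℕ.* h)                     ≤⟨ ℕ→ℚ-*-mono-≤ g h g≤ h≤ ⟩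
      C₁ * q ^ℚ i * (C₂ * r ^ℚ i)       ≡⟨ solve 4 (λ a b c d → a :* b :* (c :* d) := a :* c :* (b :* d)) refl C₁ (q ^ℚ i) C₂ (r ^ℚ i) ⟩
      C₁ * C₂ * (q ^ℚ i * r ^ℚ i)       ≡⟨ cong (C₁ * C₂ *_) (^ℚ-distribʳ-* q r i) ⟨
      C₁ * C₂ * (q * r) ^ℚ i            ∎)
      where open ≤-Reasoning

  PowerBound-⊕ : ∀ {X Y q r} → PowerBound X q → PowerBound Y r → PowerBound (X ⊕ Y) (q + r)
  PowerBound-⊕ {X} {Y} {q} {r} B₁ B₂ = record { C = C ; 0≤C = 0≤* 0≤C₁ 0≤C₂ ; bound = bounded }
    where
    open PowerBound B₁ renaming (C to C₁; 0≤C to 0≤C₁; bound to bound₁)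
    open PowerBound B₂ renaming (C to C₂; 0≤C to 0≤C₂; bound to bound₂)
    C = C₁ * C₂
    -- Splitting each coordinate of (X ⊕ Y)^{∗n} into its X- or Y-side expands
    -- (q + r)ⁿ binomially; the accumulated factor X^{∗i} ∗ Y^{∗j} carries the
    -- coordinates already split off.
    mixed : ∀ n i j → ∃ λ g → ((X ⊕ Y) ∗^ n ∗ (X ∗^ i ∗ Y ∗^ j) ⇒ F g) ×
                               (ℕ→ℚ g ≤ C * (q ^ℚ i * r ^ℚ j * (q + r) ^ℚ n))
    mixed zero i j with bound₁ i | bound₂ j
    ... | g , φ , g≤ | h , ψ , h≤ = g ℕ.* h , mulₕ g h ∘ₕ ∗-map φ ψ ∘ₕ ∗-unitˡ , (begin
      ℕ→ℚ (g ℕ.* h)                     ≤⟨ ℕ→ℚ-*-mono-≤ g h g≤ h≤ ⟩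
      C₁ * q ^ℚ i * (C₂ * r ^ℚ j)       ≡⟨ solve 4 (λ a b c d → a :* b :* (c :* d) := a :* c :* (b :* d :* con 1ℚ)) refl C₁ (q ^ℚ i) C₂ (r ^ℚ j) ⟩
      C * (q ^ℚ i * r ^ℚ j * 1ℚ)        ∎)
      where open ≤-Reasoning
    mixed (suc n) i j with mixed n (suc i) j | mixed n i (suc j)
    ... | g , φ , g≤ | h , ψ , h≤ =
      g ℕ.+ h ,
      addₕ g h ∘ₕ ⊕-map (φ ∘ₕ ∗-map idₕ ∗-assocˡ ∘ₕ ∗-exchange) (ψ ∘ₕ ∗-map idₕ ∗-exchange ∘ₕ ∗-exchange)
               ∘ₕ ∗-distribʳ-⊕ ∘ₕ ∗-assocʳ ,
      (begin
      ℕ→ℚ (g ℕ.+ h)                                          ≡⟨ ℕ→ℚ-+ g h ⟩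
      ℕ→ℚ g + ℕ→ℚ h                                          ≤⟨ +-mono-≤ g≤ h≤ ⟩
      C * (qⁱ⁺¹ * rʲ * sⁿ) + C * (qⁱ * rʲ⁺¹ * sⁿ)             ≡⟨ solve 6 (λ C q r Q R S → C :* (q :* Q :* R :* S) :+ C :* (Q :* (r :* R) :* S)
                                                                           := C :* (Q :* R :* ((q :+ r) :* S))) refl C q r qⁱ rʲ sⁿ ⟩
      C * (qⁱ * rʲ * (q + r) ^ℚ suc n)                       ∎)
      where
      open ≤-Reasoning
      qⁱ = q ^ℚ i
      rʲ = r ^ℚ j
      sⁿ = (q + r) ^ℚ n
      qⁱ⁺¹ = q ^ℚ suc i
      rʲ⁺¹ = r ^ℚ suc j
    bounded : ∀ n → ∃ λ g → ((X ⊕ Y) ∗^ n ⇒ F g) × (ℕ→ℚ g ≤ C * (q + r) ^ℚ n)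
    bounded n with mixed n 0 0
    ... | g , φ , g≤ = g , φ ∘ₕ ∗-pairʳ (tt , tt) ,
      ≤-trans g≤ (≤-reflexive (cong (C *_) (solve 1 (λ s → con 1ℚ :* con 1ℚ :* s := s) refl ((q + r) ^ℚ n))))

  PowerBound⇒Above : ∀ {X s ε} → 0ℚ ≤ s → 0ℚ < ε → PowerBound X s → Above ηF∞ F X (s + ε)
  PowerBound⇒Above {X} {s} {ε} 0≤s 0<ε B =
    let N , Csᴺ⁺¹≤ = ^ℚ-outgrows-constant C s ε 0≤C 0≤s 0<ε
        g , φ , g≤ = bound (suc N)
    in  0≤+ 0≤s (<⇒≤ 0<ε) , N , g , fromHom (φ ∘ₕ dpow⇒∗^ N) , ≤-trans g≤ Csᴺ⁺¹≤
    where open PowerBound B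

  Above-ηF∞-⊕ : ∀ {X Y q r ε} → 0ℚ < ε → Above ηF∞ F X q → Above ηF∞ F Y r → Above ηF∞ F (X ⊕ Y) (q + r + ε)
  Above-ηF∞-⊕ {X} {Y} 0<ε a@(0≤q , _) b@(0≤r , _) =
    PowerBound⇒Above (0≤+ 0≤q 0≤r) 0<ε (PowerBound-⊕ (Above⇒PowerBound {X} a) (Above⇒PowerBound {Y} b))

  Above-ηF∞-∗ : ∀ {X Y q r ε} → 0ℚ < ε → Above ηF∞ F X q → Above ηF∞ F Y r → Above ηF∞ F (X ∗ Y) (q * r + ε)
  Above-ηF∞-∗ {X} {Y} 0<ε a@(0≤q , _) b@(0≤r , _) =
    PowerBound⇒Above (0≤* 0≤q 0≤r) 0<ε (PowerBound-∗ (Above⇒PowerBound {X} a) (Above⇒PowerBound {Y} b))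

  η≤+-⊕ : ∀ η {X Y} → η≤+ η F (X ⊕ Y) X Y
  η≤+-⊕ ηF  {X} {Y} q r ε 0<ε a b = Above-mono F ηF  {X ⊕ Y} (p≤p+q (<⇒≤ 0<ε)) (Above-ηF-⊕ {X} {Y} a b)
  η≤+-⊕ ηFf {X} {Y} q r ε 0<ε a b = Above-mono F ηFf {X ⊕ Y} (p≤p+q (<⇒≤ 0<ε)) (Above-ηFf-⊕ {X} {Y} a b)
  η≤+-⊕ ηF∞ {X} {Y} q r ε 0<ε a b = Above-ηF∞-⊕ {X} {Y} 0<ε a b

  η≤*-∗ : ∀ η {X Y} → η≤* η F (X ∗ Y) X Y
  η≤*-∗ ηF  {X} {Y} q r ε 0<ε a b = Above-mono F ηF  {X ∗ Y} (p≤p+q (<⇒≤ 0<ε)) (Above-ηF-∗ {X} {Y} a b)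
  η≤*-∗ ηFf {X} {Y} q r ε 0<ε a b = Above-mono F ηFf {X ∗ Y} (p≤p+q (<⇒≤ 0<ε)) (Above-ηFf-∗ {X} {Y} a b)
  η≤*-∗ ηF∞ {X} {Y} q r ε 0<ε a b = Above-ηF∞-∗ {X} {Y} 0<ε a b

η≤-⋉ : ∀ η {F X Y} → η≤ η F (X ⋉ Y) (X ∗ Y)
η≤-⋉ η {F} {X} {Y} q ε 0<ε a = Above-mono F η {X ⋉ Y} (p≤p+q (<⇒≤ 0<ε)) (Above-antitone F η {X ⋉ Y} {X ∗ Y} ⋉⇒∗ a)

proposition4p4 : (F : ℕ → Graph) → SemiringFamily F → (η : Param) →
    (G H : Graph) → Finite G → Finite H →
    η≤+ η F (G ⊕ H) G H × η≤ η F (G ⋉ H) (G ∗ H) × η≤* η F (G ∗ H) G H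
proposition4p4 F sf η G H _ _ = η≤+-⊕ sf η , η≤-⋉ η , η≤*-∗ sf η
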